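{- Let $v\in a_{k,l}(n)$ and $A\in I(k,l)$, and let $v\mapsto(P,Q)$ under the $A$-RSK and $v\mapsto(P^*,Q^*)$ under the dual-$A$-RSK. If no $u$-letter occurs more than once in $v$, then $P=P^*$ and $Q=Q^*$.
   Context: Let $t_1,\dots,t_k,u_1,\dots,u_l$ be distinct symbols ("$t$-letters" and "$u$-letters"). A shuffle is a total order $<_A$ with $t_1<_A\cdots<_A t_k$ and $u_1<_A\cdots<_A u_l$; $I(k,l)$ is the set of shuffles. $a_{k,l}(n)$ is the set of words $v_1\cdots v_n$ in these letters. $c(i,j)$ is the cell in row $i$, column $j$ (English convention). The $A$-RSK insertion of a letter $x$ proceeds in steps: initially $x$ is inserted into row 1 if a $t$-letter, into column 1 if a $u$-letter. Inserting a $t$-letter $y$ into row $r$: $y$ bumps the leftmost entry of row $r$ strictly $A$-greater than $y$, or if none, is placed in a new cell at the end of row $r$. Inserting a $u$-letter $y$ into column $c$: $y$ bumps the topmost entry of column $c$ strictly $A$-greater than $y$, or if none, is placed in a new cell at the bottom of column $c$. An entry bumped from $c(i,j)$ is next inserted into row $i+1$ if a $t$-letter, into column $j+1$ if a $u$-letter; insertion ends when a new cell is created. The dual-$A$-RSK is identical except that a $u$-letter $y$ inserted into column $c$ bumps the topmost entry of column $c$ that is $A$-greater than or equal to $y$. In each case the insertion tableau is obtained by inserting $v_1,\dots,v_n$ successively into the empty tableau, and the recording tableau is the standard Young tableau of the same shape with entry $m$ in the cell created while inserting $v_m$. -}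

module Defs where

open import Data.Nat using (ℕ; zero; suc; _<_; _≤_; _<?_; _≤?_)
open import Data.Fin as Fin using (Fin)
open import Data.Bool using (Bool; true; false)
open import Data.Maybe using (Maybe; just; nothing)
open import Data.List using (List; []; _∷_; _∷ʳ_; length)
open import Data.Vec using (Vec; toList)
open import Data.Product using (_×_; _,_)
open import Relation.Nullary.Decidable using (⌊_⌋)
open import Relation.Binary.PropositionalEquality using (_≡_)

data Letter (k l : ℕ) : Set where
  t : Fin k → Letter k l
  u : Fin l → Letter k l

Word : ℕ → ℕ → ℕ → Set
Word k l n = Vec (Letter k l) n

-- Shuffles I(k,l): a total order <_A on the k+l letters, given by an
-- injective rank function (x <_A y iff rank x < rank y), with
-- t_1 <_A ⋯ <_A t_k and u_1 <_A ⋯ <_A u_l.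

record Shuffle (k l : ℕ) : Set where
  field
    rank     : Letter k l → ℕ
    rank-inj : ∀ x y → rank x ≡ rank y → x ≡ y
    t-mono   : ∀ i j → i Fin.< j → rank (t i) < rank (t j)
    u-mono   : ∀ i j → i Fin.< j → rank (u i) < rank (u j)

open Shuffle public

_<ᴬ?_ : ∀ {k l} → Shuffle k l → Letter k l → Letter k l → Bool
_<ᴬ?_ A x y = ⌊ rank A x <? rank A y ⌋
_≤ᴬ?_ : ∀ {k l} → Shuffle k l → Letter k l → Letter k l → Bool
_≤ᴬ?_ A x y = ⌊ rank A x ≤? rank A y ⌋

-- Tableaux: list of rows (row 1 first), each row a list (column 1 first).
-- Indices are 0-based: cell c(i+1, j+1) is position (i , j).

Tableau : Set → Set
Tableau X = List (List X)

rowOf : ∀ {X : Set} → Tableau X → ℕ → List X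
rowOf []       _       = []
rowOf (R ∷ T)  zero    = R
rowOf (R ∷ T)  (suc i) = rowOf T i

lookupL : ∀ {X : Set} → List X → ℕ → Maybe X
lookupL []       _       = nothing
lookupL (x ∷ xs) zero    = just x
lookupL (x ∷ xs) (suc j) = lookupL xs j

colOf : ∀ {X : Set} → Tableau X → ℕ → List X
colOf []      j = []
colOf (R ∷ T) j with lookupL R j
... | just x  = x ∷ colOf T j
... | nothing = []

firstIdx : ∀ {X : Set} → (X → Bool) → List X → Maybe (ℕ × X)
firstIdx p []       = nothing
firstIdx p (x ∷ xs) with p x
... | true  = just (0 , x)
... | false with firstIdx p xs
...   | just (j , y) = just (suc j , y)
...   | nothing      = nothing

setL : ∀ {X : Set} → List X → ℕ → X → List X
setL []       _       _ = []
setL (x ∷ xs) zero    y = y ∷ xs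
setL (x ∷ xs) (suc j) y = x ∷ setL xs j y

setCell : ∀ {X : Set} → Tableau X → ℕ → ℕ → X → Tableau X
setCell []      _       _ _ = []
setCell (R ∷ T) zero    j y = setL R j y ∷ T
setCell (R ∷ T) (suc i) j y = R ∷ setCell T i j y

-- add a new cell at the end of row i (row i = length T creates a new row)
addCell : ∀ {X : Set} → Tableau X → ℕ → X → Tableau X
addCell []      zero    y = (y ∷ []) ∷ []
addCell []      (suc i) y = []
addCell (R ∷ T) zero    y = (R ∷ʳ y) ∷ T
addCell (R ∷ T) (suc i) y = R ∷ addCell T i y

data Target : Set where
  row : ℕ → Target
  col : ℕ → Target

initTarget : ∀ {k l} → Letter k l → Target
initTarget (t _) = row 0
initTarget (u _) = col 0

nextTarget : ∀ {k l} → Letter k l → ℕ → ℕ → Target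
nextTarget (t _) i j = row (suc i)
nextTarget (u _) i j = col (suc j)

-- dual = false : A-RSK ; dual = true : dual-A-RSK
-- (only the column bump rule differs)
colBumps : ∀ {k l} → Bool → Shuffle k l → Letter k l → Letter k l → Bool
colBumps false A y z = _<ᴬ?_ A y z
colBumps true  A y z = _≤ᴬ?_ A y z

-- Ins d A T y τ T' (i , j) : inserting y with target τ into T ends with
-- tableau T', the newly created cell being (i , j).
data Ins {k l : ℕ} (d : Bool) (A : Shuffle k l) :
         Tableau (Letter k l) → Letter k l → Target →
         Tableau (Letter k l) → ℕ × ℕ → Set where
  rowNew  : ∀ {T y r} →
            firstIdx (_<ᴬ?_ A y) (rowOf T r) ≡ nothing →
            Ins d A T y (row r) (addCell T r y) (r , length (rowOf T r))
  rowBump : ∀ {T y r j z T' c} →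
            firstIdx (_<ᴬ?_ A y) (rowOf T r) ≡ just (j , z) →
            Ins d A (setCell T r j y) z (nextTarget z r j) T' c →
            Ins d A T y (row r) T' c
  colNew  : ∀ {T y c} →
            firstIdx (colBumps d A y) (colOf T c) ≡ nothing →
            length (rowOf T (length (colOf T c))) ≡ c →
            Ins d A T y (col c) (addCell T (length (colOf T c)) y)
                (length (colOf T c) , c)
  colBump : ∀ {T y c i z T' e} →
            firstIdx (colBumps d A y) (colOf T c) ≡ just (i , z) →
            Ins d A (setCell T i c y) z (nextTarget z i c) T' e →
            Ins d A T y (col c) T' e

-- Successive insertion of a list of letters; m = number of letters
-- already inserted; the recording tableau gets entry m+1 in the new cell.
data RSKfrom {k l : ℕ} (d : Bool) (A : Shuffle k l) :
     ℕ → Tableau (Letter k l) → Tableau ℕ → List (Letter k l) →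
     Tableau (Letter k l) → Tableau ℕ → Set where
  done : ∀ {m P Q} → RSKfrom d A m P Q [] P Q
  step : ∀ {m P Q x xs P' i j Pf Qf} →
         Ins d A P x (initTarget x) P' (i , j) →
         RSKfrom d A (suc m) P' (addCell Q i (suc m)) xs Pf Qf →
         RSKfrom d A m P Q (x ∷ xs) Pf Qf

ARSK : ∀ {k l n} → Shuffle k l → Word k l n →
       Tableau (Letter k l) → Tableau ℕ → Set
ARSK A v P Q = RSKfrom false A 0 [] [] (toList v) P Q

DualARSK : ∀ {k l n} → Shuffle k l → Word k l n →
           Tableau (Letter k l) → Tableau ℕ → Set
DualARSK A v P Q = RSKfrom true A 0 [] [] (toList v) P Q

{-# OPTIONS --safe #-}
-- The two insertions differ only when a u-letter y meets an entry equal to y in a column.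
-- Call a configuration (tableau, letters still to be inserted, the first being the letter in
-- hand) u-distinct if no u-letter occurs twice in it.  A bump swaps the letter in hand with
-- the bumped entry and a new cell only adds the letter in hand, so u-distinctness is preserved
-- along both insertions; in particular a u-letter in hand never occurs in the tableau, so the
-- strict and the weak column rules choose the same entry at every step.
module Submission where

open import Defs
open import Data.Bool using (Bool; true; false)
open import Data.Empty using (⊥-elim)
open import Data.Fin as Fin using (Fin)
open import Data.Fin.Properties using (suc-injective; 0≢1+n)
open import Data.List using (List; []; _∷_; _∷ʳ_)
open import Data.Maybe using (just)
open import Data.Nat using (ℕ; zero; suc; _+_; _≤_; _<?_; _≤?_; z≤n; s≤s)
open import Data.Nat.Properties
  using (+-assoc; +-identityʳ; +-commutativeSemigroup; +-mono-≤; +-monoˡ-≤; +-monoʳ-≤;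
         m≤m+n; m≤n+m; ≤-reflexive; ≤-trans; <⇒≤; ≤∧≢⇒<; 1+n≰n; module ≤-Reasoning)
open import Algebra.Properties.CommutativeSemigroup +-commutativeSemigroup
  using (xy∙z≈zy∙x; xy∙z≈xz∙y)
open import Data.Product using (_×_; _,_)
open import Data.Sum using (_⊎_; inj₁; inj₂)
open import Data.Vec using (lookup; toList) renaming ([] to []ᵥ; _∷_ to _∷ᵥ_)
open import Function using (_∘_)
open import Relation.Nullary using (Dec; yes; no; ¬_)
open import Relation.Nullary.Decidable using (⌊_⌋)
open import Relation.Binary.PropositionalEquality

firstIdx-lookup : ∀ {X : Set} (p : X → Bool) (xs : List X) {j z} →
                  firstIdx p xs ≡ just (j , z) → lookupL xs j ≡ just z
firstIdx-lookup p (x ∷ xs) e with p x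
firstIdx-lookup p (x ∷ xs) refl | true = refl
... | false with firstIdx p xs in found
firstIdx-lookup p (x ∷ xs) refl | false | just _ = firstIdx-lookup p xs found

firstIdx-cong : ∀ {X : Set} (p q : X → Bool) (xs : List X) →
                (∀ i z → lookupL xs i ≡ just z → p z ≡ q z) →
                firstIdx p xs ≡ firstIdx q xs
firstIdx-cong p q []       p≗q = refl
firstIdx-cong p q (x ∷ xs) p≗q with p x | q x | p≗q 0 x refl
... | true  | true  | refl = refl
... | false | false | refl
  rewrite firstIdx-cong p q xs (λ i → p≗q (suc i)) = refl

lookupL-colOf : ∀ {X : Set} (T : Tableau X) c i {z} →
                lookupL (colOf T c) i ≡ just z → lookupL (rowOf T i) c ≡ just z
lookupL-colOf (R ∷ T) c i e with lookupL R c in entry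
lookupL-colOf (R ∷ T) c zero    refl | just _ = entry
lookupL-colOf (R ∷ T) c (suc i) e    | just _ = lookupL-colOf T c i e

+-congˡ-assoc : ∀ a {b c d e} → b + c ≡ d + e → a + b + c ≡ a + d + e
+-congˡ-assoc a {b} {c} {d} {e} eq = begin
  a + b + c    ≡⟨ +-assoc a b c ⟩
  a + (b + c)  ≡⟨ cong (a +_) eq ⟩
  a + (d + e)  ≡⟨ +-assoc a d e ⟨
  a + d + e    ∎
  where open ≡-Reasoning

module _ {X : Set} (w : X → ℕ) where

  weightᴸ : List X → ℕ
  weightᴸ []      = 0
  weightᴸ (x ∷ R) = w x + weightᴸ R

  weight : Tableau X → ℕ
  weight []      = 0
  weight (R ∷ T) = weightᴸ R + weight T

  weightᴸ-entry : ∀ R j {z} → lookupL R j ≡ just z → w z ≤ weightᴸ R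
  weightᴸ-entry (x ∷ R) zero    refl = m≤m+n (w x) (weightᴸ R)
  weightᴸ-entry (x ∷ R) (suc j) e    = ≤-trans (weightᴸ-entry R j e) (m≤n+m _ (w x))

  weight-entry : ∀ T i j {z} → lookupL (rowOf T i) j ≡ just z → w z ≤ weight T
  weight-entry (R ∷ T) zero    j e = ≤-trans (weightᴸ-entry R j e) (m≤m+n _ (weight T))
  weight-entry (R ∷ T) (suc i) j e = ≤-trans (weight-entry T i j e) (m≤n+m _ (weightᴸ R))

  weightᴸ-setL : ∀ R j y {z} → lookupL R j ≡ just z →
                 weightᴸ (setL R j y) + w z ≡ weightᴸ R + w y
  weightᴸ-setL (x ∷ R) zero    y refl = xy∙z≈zy∙x (w y) (weightᴸ R) (w x)
  weightᴸ-setL (x ∷ R) (suc j) y e    = +-congˡ-assoc (w x) (weightᴸ-setL R j y e)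

  weight-setCell : ∀ T i j y {z} → lookupL (rowOf T i) j ≡ just z →
                   weight (setCell T i j y) + w z ≡ weight T + w y
  weight-setCell (R ∷ T) zero    j y {z} e = begin
    weightᴸ (setL R j y) + weight T + w z  ≡⟨ xy∙z≈xz∙y _ (weight T) (w z) ⟩
    weightᴸ (setL R j y) + w z + weight T  ≡⟨ cong (_+ weight T) (weightᴸ-setL R j y e) ⟩
    weightᴸ R + w y + weight T             ≡⟨ xy∙z≈xz∙y (weightᴸ R) (w y) (weight T) ⟩
    weightᴸ R + weight T + w y             ∎
    where open ≡-Reasoning
  weight-setCell (R ∷ T) (suc i) j y e = +-congˡ-assoc (weightᴸ R) (weight-setCell T i j y e)

  weightᴸ-∷ʳ : ∀ R y → weightᴸ (R ∷ʳ y) ≡ weightᴸ R + w y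
  weightᴸ-∷ʳ []      y = +-identityʳ (w y)
  weightᴸ-∷ʳ (x ∷ R) y = begin
    w x + weightᴸ (R ∷ʳ y)  ≡⟨ cong (w x +_) (weightᴸ-∷ʳ R y) ⟩
    w x + (weightᴸ R + w y) ≡⟨ +-assoc (w x) (weightᴸ R) (w y) ⟨
    w x + weightᴸ R + w y   ∎
    where open ≡-Reasoning

  -- Only ≤: addCell at a row index beyond length T leaves T unchanged.
  weight-addCell : ∀ T i y → weight (addCell T i y) ≤ weight T + w y
  weight-addCell []      zero    y =
    ≤-reflexive (trans (+-identityʳ (w y + 0)) (+-identityʳ (w y)))
  weight-addCell []      (suc i) y = z≤n
  weight-addCell (R ∷ T) zero    y = ≤-reflexive (begin
    weightᴸ (R ∷ʳ y) + weight T  ≡⟨ cong (_+ weight T) (weightᴸ-∷ʳ R y) ⟩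
    weightᴸ R + w y + weight T   ≡⟨ xy∙z≈xz∙y (weightᴸ R) (w y) (weight T) ⟩
    weightᴸ R + weight T + w y   ∎)
    where open ≡-Reasoning
  weight-addCell (R ∷ T) (suc i) y = begin
    weightᴸ R + weight (addCell T i y)  ≤⟨ +-monoʳ-≤ (weightᴸ R) (weight-addCell T i y) ⟩
    weightᴸ R + (weight T + w y)        ≡⟨ +-assoc (weightᴸ R) (weight T) (w y) ⟨
    weightᴸ R + weight T + w y          ∎
    where open ≤-Reasoning

weight-ins : ∀ {k l d} {A : Shuffle k l} (w : Letter k l → ℕ) {T y τ T' c} →
             Ins d A T y τ T' c → weight w T' ≤ weight w T + w y
weight-ins w {T} {y} (rowNew {r = r} _) = weight-addCell w T r y
weight-ins w {T} {y} (colNew _ _)       = weight-addCell w T _ y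
weight-ins w {T} {y} (rowBump {r = r} {j} {z} found I) =
  ≤-trans (weight-ins w I) (≤-reflexive (weight-setCell w T r j y bumped))
  where
  bumped : lookupL (rowOf T r) j ≡ just z
  bumped = firstIdx-lookup _ (rowOf T r) found
weight-ins w {T} {y} (colBump {c = c} {i} {z} found I) =
  ≤-trans (weight-ins w I) (≤-reflexive (weight-setCell w T i c y bumped))
  where
  bumped : lookupL (rowOf T i) c ≡ just z
  bumped = lookupL-colOf T c i (firstIdx-lookup _ (colOf T c) found)

module _ {k l : ℕ} where

  countU : Fin l → Letter k l → ℕ
  countU b (t _) = 0
  countU b (u a) with a Fin.≟ b
  ... | yes _ = 1
  ... | no  _ = 0

  countU-self : ∀ b → countU b (u b) ≡ 1
  countU-self b with b Fin.≟ b
  ... | yes _   = refl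
  ... | no  b≢b = ⊥-elim (b≢b refl)

  countU≡0⊎≡u : ∀ b x → countU b x ≡ 0 ⊎ x ≡ u b
  countU≡0⊎≡u b (t _) = inj₁ refl
  countU≡0⊎≡u b (u a) with a Fin.≟ b
  ... | yes refl = inj₂ refl
  ... | no  _    = inj₁ refl

  record DistinctU (T : Tableau (Letter k l)) (xs : List (Letter k l)) : Set where
    constructor distinctU
    field bound : ∀ b → weight (countU b) T + weightᴸ (countU b) xs ≤ 1

  open DistinctU

  distinctU-fresh : ∀ T {b xs} → DistinctU T (u b ∷ xs) →
                    ∀ i j → ¬ lookupL (rowOf T i) j ≡ just (u b)
  distinctU-fresh T {b} {xs} distinct i j e
    with weight-entry (countU b) T i j e | bound distinct b
  ... | inT | total rewrite countU-self b =
    1+n≰n (≤-trans (+-mono-≤ inT (m≤m+n 1 (weightᴸ (countU b) xs))) total)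

  distinctU-setCell : ∀ {T xs} i j y {z} → lookupL (rowOf T i) j ≡ just z →
                      DistinctU T (y ∷ xs) → DistinctU (setCell T i j y) (z ∷ xs)
  distinctU-setCell {T} {xs} i j y {z} e distinct = distinctU bound-after
    where
    bound-after : ∀ b → weight (countU b) (setCell T i j y) + weightᴸ (countU b) (z ∷ xs) ≤ 1
    bound-after b = begin
      weight (countU b) (setCell T i j y) + (countU b z + rest)
        ≡⟨ +-assoc _ (countU b z) rest ⟨
      weight (countU b) (setCell T i j y) + countU b z + rest
        ≡⟨ cong (_+ rest) (weight-setCell (countU b) T i j y e) ⟩
      weight (countU b) T + countU b y + rest
        ≡⟨ +-assoc _ (countU b y) rest ⟩
      weight (countU b) T + (countU b y + rest)
        ≤⟨ bound distinct b ⟩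
      1 ∎
      where open ≤-Reasoning
            rest : ℕ
            rest = weightᴸ (countU b) xs

  distinctU-ins : ∀ {d A T y τ T' c xs} → Ins d A T y τ T' c →
                  DistinctU T (y ∷ xs) → DistinctU T' xs
  distinctU-ins {T = T} {y} {xs = xs} I distinct = distinctU λ b →
    ≤-trans (+-monoˡ-≤ (weightᴸ (countU b) xs) (weight-ins (countU b) I))
            (≤-trans (≤-reflexive (+-assoc (weight (countU b) T) (countU b y) _)) (bound distinct b))

  countU-absent : ∀ {n} (v : Word k l n) b → (∀ i → ¬ lookup v i ≡ u b) →
                  weightᴸ (countU b) (toList v) ≡ 0
  countU-absent []ᵥ      b absent = refl
  countU-absent (x ∷ᵥ v) b absent with countU≡0⊎≡u b x
  ... | inj₁ x∉ rewrite x∉ = countU-absent v b (absent ∘ Fin.suc)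
  ... | inj₂ refl = ⊥-elim (absent Fin.zero refl)

  countU-word-≤1 : ∀ {n} (v : Word k l n) →
                   (∀ a i j → lookup v i ≡ u a → lookup v j ≡ u a → i ≡ j) →
                   ∀ b → weightᴸ (countU b) (toList v) ≤ 1
  countU-word-≤1 []ᵥ      distinct b = z≤n
  countU-word-≤1 (x ∷ᵥ v) distinct b with countU≡0⊎≡u b x
  ... | inj₁ x∉ rewrite x∉ =
    countU-word-≤1 v (λ a i j p q → suc-injective (distinct a (Fin.suc i) (Fin.suc j) p q)) b
  ... | inj₂ refl
    rewrite countU-self b
          | countU-absent v b (λ i e → 0≢1+n (distinct b Fin.zero (Fin.suc i) refl e)) = s≤s z≤n

  data Routed : Letter k l → Target → Set where
    row-routed : ∀ {y r} → Routed y (row r)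
    col-routed : ∀ {b c} → Routed (u b) (col c)

  routed-init : ∀ x → Routed x (initTarget x)
  routed-init (t _) = row-routed
  routed-init (u _) = col-routed

  routed-next : ∀ z i j → Routed z (nextTarget z i j)
  routed-next (t _) i j = row-routed
  routed-next (u _) i j = col-routed

⌊⌋-cong-⇔ : ∀ {a b} {A : Set a} {B : Set b} (a? : Dec A) (b? : Dec B) →
            (A → B) → (B → A) → ⌊ a? ⌋ ≡ ⌊ b? ⌋
⌊⌋-cong-⇔ (yes _)  (yes _)  _  _    = refl
⌊⌋-cong-⇔ (no _)   (no _)   _  _    = refl
⌊⌋-cong-⇔ (yes a)  (no ¬b)  to _    = ⊥-elim (¬b (to a))
⌊⌋-cong-⇔ (no ¬a)  (yes b)  _  from = ⊥-elim (¬a (from b))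

⌊<?⌋≡⌊≤?⌋ : ∀ {m n} → m ≢ n → ⌊ m <? n ⌋ ≡ ⌊ m ≤? n ⌋
⌊<?⌋≡⌊≤?⌋ {m} {n} m≢n = ⌊⌋-cong-⇔ (m <? n) (m ≤? n) <⇒≤ (λ m≤n → ≤∧≢⇒< m≤n m≢n)

colBumps-dual-agree : ∀ {k l} (A : Shuffle k l) {y z} → z ≢ y →
                      colBumps false A y z ≡ colBumps true A y z
colBumps-dual-agree A {y} {z} z≢y = ⌊<?⌋≡⌊≤?⌋ (z≢y ∘ sym ∘ rank-inj A y z)

module _ {k l : ℕ} (A : Shuffle k l) where

  colSearch-dual-agree : ∀ T c {b xs} → DistinctU T (u b ∷ xs) →
                         firstIdx (colBumps false A (u b)) (colOf T c)
                           ≡ firstIdx (colBumps true A (u b)) (colOf T c)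
  colSearch-dual-agree T c distinct = firstIdx-cong _ _ (colOf T c) λ i z e →
    colBumps-dual-agree A λ { refl → distinctU-fresh T distinct i c (lookupL-colOf T c i e) }

  ins-dual-agree : ∀ {T y τ T₁ c₁ T₂ c₂ xs} →
                   Ins false A T y τ T₁ c₁ → Ins true A T y τ T₂ c₂ →
                   Routed y τ → DistinctU T (y ∷ xs) → T₁ ≡ T₂ × c₁ ≡ c₂
  ins-dual-agree (rowNew _) (rowNew _) _ _ = refl , refl
  ins-dual-agree (rowNew found₁) (rowBump found₂ _) _ _ with () ← trans (sym found₁) found₂
  ins-dual-agree (rowBump found₁ _) (rowNew found₂) _ _ with () ← trans (sym found₁) found₂
  ins-dual-agree {T} {y} (rowBump {r = r} {j} {z} found₁ I₁) (rowBump found₂ I₂) _ distinct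
    with refl ← trans (sym found₁) found₂ =
    ins-dual-agree I₁ I₂ (routed-next z r j)
      (distinctU-setCell r j y (firstIdx-lookup _ (rowOf T r) found₁) distinct)
  ins-dual-agree (colNew _ _) (colNew _ _) _ _ = refl , refl
  ins-dual-agree {T} (colNew {c = c} found₁ _) (colBump found₂ _) col-routed distinct
    with () ← trans (sym found₁) (trans (colSearch-dual-agree T c distinct) found₂)
  ins-dual-agree {T} (colBump {c = c} found₁ _) (colNew found₂ _) col-routed distinct
    with () ← trans (sym found₁) (trans (colSearch-dual-agree T c distinct) found₂)
  ins-dual-agree {T} {y} (colBump {c = c} {i} {z} found₁ I₁) (colBump found₂ I₂) col-routed
                 distinct
    with refl ← trans (sym found₁) (trans (colSearch-dual-agree T c distinct) found₂) =
    ins-dual-agree I₁ I₂ (routed-next z i c)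
      (distinctU-setCell i c y (lookupL-colOf T c i (firstIdx-lookup _ (colOf T c) found₁))
                         distinct)

  rsk-dual-agree : ∀ {m P Q xs P₁ Q₁ P₂ Q₂} →
                   RSKfrom false A m P Q xs P₁ Q₁ → RSKfrom true A m P Q xs P₂ Q₂ →
                   DistinctU P xs → P₁ ≡ P₂ × Q₁ ≡ Q₂
  rsk-dual-agree done done _ = refl , refl
  rsk-dual-agree (step {x = x} I₁ R₁) (step I₂ R₂) distinct
    with refl , refl ← ins-dual-agree I₁ I₂ (routed-init x) distinct =
    rsk-dual-agree R₁ R₂ (distinctU-ins I₁ distinct)

lemma3p2 : ∀ {k l n : ℕ} (v : Word k l n) (A : Shuffle k l)
           (P P* : Tableau (Letter k l)) (Q Q* : Tableau ℕ) →
           (∀ (a : Fin l) (i j : Fin n) →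
              lookup v i ≡ u a → lookup v j ≡ u a → i ≡ j) →
           ARSK A v P Q → DualARSK A v P* Q* →
           P ≡ P* × Q ≡ Q*
lemma3p2 v A P P* Q Q* distinct rsk dual-rsk =
  rsk-dual-agree A rsk dual-rsk (distinctU (countU-word-≤1 v distinct))
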